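{- Let $g_n(y)=\sum_{[\pi]\in\mathfrak{C}_n^o}y^{\operatorname{drop}_{eo}([\pi])}$. Then $g_1=1$ and for every $n\ge1$: (i) $g_{2n}=nyg_{2n-1}-y^2\frac{d}{dy}g_{2n-1}+y\frac{d}{dy}g_{2n-1}$; (ii) $g_{2n+1}=ng_{2n}-y\frac{d}{dy}g_{2n}+\frac{d}{dy}g_{2n}$.
   Context: Let $\mathfrak{S}_n$ be the set of permutations of $[n]=\{1,\dots,n\}$, written as words $\pi=\pi_1\cdots\pi_n$. Two permutations are equivalent if one is a cyclic rotation of the other; a cycle $[\pi]$ on $[n]$ is an equivalence class, and $\mathfrak{C}_n$ is the set of cycles on $[n]$. Choose the representative with $\pi_1=1$ and read indices cyclically ($\pi_{n+1}=\pi_1$). A drop of $[\pi]$ is a pair $(\pi_i,\pi_{i+1})$, $1\le i\le n$, with $\pi_i>\pi_{i+1}$. A drop is even-odd if $\pi_i$ is even and $\pi_{i+1}$ is odd; $\operatorname{drop}_{eo}([\pi])$ is the number of even-odd drops of $[\pi]$. By convention, the unique cycle $[(1)]$ on $[1]$ has exactly one drop $(\star,1)$, where $\star$ is considered neither even nor odd (so this drop is not even-odd, but its second entry is odd). $\mathfrak{C}_n^o=\{[\pi]\in\mathfrak{C}_n:\ \pi_{i+1}\text{ is odd for every drop }(\pi_i,\pi_{i+1})\text{ of }[\pi]\}$. -}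

module Defs where

open import Data.Nat as ℕ using (ℕ; zero; suc; _<ᵇ_; _≡ᵇ_)
open import Data.Bool using (Bool; true; false; _∧_; _∨_; not; if_then_else_)
open import Data.List using (List; []; _∷_; map; concatMap; length; filterᵇ; upTo)
open import Data.Product using (_×_; _,_)
open import Data.Integer as ℤ using (ℤ; +_)
open import Relation.Binary.PropositionalEquality using (_≡_)

isEven : ℕ → Bool
isEven zero = true
isEven (suc n) = not (isEven n)

isOdd : ℕ → Bool
isOdd n = not (isEven n)

insertions : ℕ → List ℕ → List (List ℕ)
insertions x [] = (x ∷ []) ∷ []
insertions x (y ∷ ys) = (x ∷ y ∷ ys) ∷ map (y ∷_) (insertions x ys)

perms : List ℕ → List (List ℕ)
perms [] = [] ∷ []
perms (x ∷ xs) = concatMap (insertions x) (perms xs)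

-- Cycles on [n], each given by its unique representative word with π₁ = 1:
-- the words 1 ∷ σ where σ ranges over all permutations of 2,…,n.
-- (Intended for n ≥ 1.)
cycles : ℕ → List (List ℕ)
cycles n = map (1 ∷_) (perms (map (λ i → suc (suc i)) (upTo (n ℕ.∸ 1))))

cyclicPairsFrom : ℕ → List ℕ → List (ℕ × ℕ)
cyclicPairsFrom first [] = []
cyclicPairsFrom first (y ∷ []) = (y , first) ∷ []
cyclicPairsFrom first (y ∷ z ∷ r) = (y , z) ∷ cyclicPairsFrom first (z ∷ r)

cyclicPairs : List ℕ → List (ℕ × ℕ)
cyclicPairs [] = []
cyclicPairs (x ∷ xs) = cyclicPairsFrom x (x ∷ xs)

drops : List ℕ → List (ℕ × ℕ)
drops π = filterᵇ (λ { (a , b) → b <ᵇ a }) (cyclicPairs π)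

isEvenOdd : ℕ × ℕ → Bool
isEvenOdd (a , b) = isEven a ∧ isOdd b

dropEO : List ℕ → ℕ
dropEO π = length (filterᵇ isEvenOdd (drops π))

allᵇ : {A : Set} → (A → Bool) → List A → Bool
allᵇ p [] = true
allᵇ p (x ∷ xs) = p x ∧ allᵇ p xs

inCo : List ℕ → Bool
inCo π = allᵇ (λ { (a , b) → isOdd b }) (drops π)

-- Polynomials in y with integer coefficients, as coefficient sequences
-- (p k = coefficient of y^k), with pointwise equality.

Poly : Set
Poly = ℕ → ℤ

_≈ₚ_ : Poly → Poly → Set
p ≈ₚ q = ∀ k → p k ≡ q k

infix 4 _≈ₚ_

oneₚ : Poly
oneₚ zero = + 1
oneₚ (suc k) = + 0

_+ₚ_ : Poly → Poly → Poly
(p +ₚ q) k = p k ℤ.+ q k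

_-ₚ_ : Poly → Poly → Poly
(p -ₚ q) k = p k ℤ.- q k

infixl 6 _+ₚ_ _-ₚ_

_·ₚ_ : ℕ → Poly → Poly
(c ·ₚ p) k = + c ℤ.* p k

infixl 7 _·ₚ_

yₚ : Poly → Poly
yₚ p zero = + 0
yₚ p (suc k) = p k

dₚ : Poly → Poly
dₚ p k = + (suc k) ℤ.* p (suc k)

g : ℕ → Poly
g n k = + length (filterᵇ (λ π → inCo π ∧ (dropEO π ≡ᵇ k)) (cycles n))

module Submission where

-- Every cycle on [m], m ≥ 2, arises exactly once by inserting m into a cycle on [m - 1],
-- that is, by subdividing one of its cyclic pairs (x , y) into (x , m) and (m , y).
-- The pair (x , m) is an ascent and (m , y) a drop, so the new cycle lies in 𝔆ᵒ iff the
-- old one does and y is odd; its number of even-odd drops is the old number c, minus one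
-- if (x , y) was an even-odd drop, plus one if m is even.  In a cycle of 𝔆ᵒ all c
-- even-odd drops are among the pairs ending in an odd entry, and there are n = ⌊m/2⌋ of
-- those.  Hence a cycle of weight y^c contributes y^e (c y^(c-1) + (n - c) y^c), where
-- e = 1 if m is even and e = 0 otherwise, and summing gives
-- g_m = y^e (n g_(m-1) - y g_(m-1)' + g_(m-1)').

open import Defs
open import Data.Nat using (ℕ; zero; suc; s<s; z<s; _+_; _*_; _∸_; _≤_; _<_; _<ᵇ_; _≡ᵇ_)
open import Data.Nat.Properties
  using (+-comm; *-comm; *-suc; *-zeroʳ; *-identityʳ; <-asym; <ᵇ⇒<; <⇒<ᵇ; ≡ᵇ⇒≡; +-commutativeSemigroup)
open import Data.Nat.ListAction using (sum)
open import Data.Nat.ListAction.Properties using (sum-++; sum-↭)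
open import Algebra.Properties.CommutativeSemigroup +-commutativeSemigroup using (x∙yz≈y∙xz)
open import Data.Nat.Tactic.RingSolver using (solve-∀)
open import Data.Bool using (Bool; true; false; _∧_; _∨_; not)
open import Data.Bool.Properties using (not-involutive; T-≡; ∧-assoc; ∧-zeroʳ; ∧-identityʳ; ∨-zeroʳ)
open import Data.List using (List; []; _∷_; _++_; [_]; _∷ʳ_; map; concatMap; length; filterᵇ; upTo)
open import Data.List.Properties using (++-assoc; upTo-∷ʳ; map-++; map-∘; concatMap-++)
open import Data.List.Relation.Unary.All as All using (All; []; _∷_; head)
import Data.List.Relation.Unary.All.Properties as Allₚ
open import Data.List.Relation.Binary.Permutation.Propositional
  using (_↭_; ↭-sym; prep; swap; module PermutationReasoning) renaming (refl to ↭-refl; trans to ↭-trans)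
open import Data.List.Relation.Binary.Permutation.Propositional.Properties
  using (All-resp-↭; ++⁺; ++⁺ˡ; shifts; map⁺)
open import Data.Integer as ℤ using (ℤ)
import Data.Integer.Properties as ℤ
open import Data.Integer.Tactic.RingSolver using () renaming (solve-∀ to ℤ-solve-∀)
open import Data.Product using (_×_; _,_; proj₁; proj₂)
open import Function using (_∘_; Equivalence)
open import Relation.Nullary using (contradiction)
open import Relation.Binary.PropositionalEquality using (_≡_; refl; sym; trans; cong; cong₂; subst; module ≡-Reasoning)

private
  variable
    A B : Set

χ : Bool → ℕ
χ true = 1
χ false = 0

count : (A → Bool) → List A → ℕ
count p xs = sum (map (λ x → χ (p x)) xs)

length-filterᵇ : (p : A → Bool) (xs : List A) → length (filterᵇ p xs) ≡ count p xs
length-filterᵇ p [] = refl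
length-filterᵇ p (x ∷ xs) with p x
... | true = cong suc (length-filterᵇ p xs)
... | false = length-filterᵇ p xs

count-filterᵇ : (p q : A → Bool) (xs : List A) → count p (filterᵇ q xs) ≡ count (λ x → q x ∧ p x) xs
count-filterᵇ p q [] = refl
count-filterᵇ p q (x ∷ xs) with q x
... | true = cong (χ (p x) +_) (count-filterᵇ p q xs)
... | false = count-filterᵇ p q xs

count-++ : (p : A → Bool) (xs ys : List A) → count p (xs ++ ys) ≡ count p xs + count p ys
count-++ p xs ys = trans (cong sum (map-++ _ xs ys)) (sum-++ (map _ xs) _)

count-map : (p : B → Bool) (f : A → B) (xs : List A) → count p (map f xs) ≡ count (p ∘ f) xs
count-map p f xs = cong sum (sym (map-∘ xs))

count-concatMap : (p : B → Bool) (f : A → List B) (xs : List A) →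
  count p (concatMap f xs) ≡ sum (map (count p ∘ f) xs)
count-concatMap p f [] = refl
count-concatMap p f (x ∷ xs) = trans (count-++ p (f x) _) (cong (count p (f x) +_) (count-concatMap p f xs))

count-↭ : (p : A → Bool) {xs ys : List A} → xs ↭ ys → count p xs ≡ count p ys
count-↭ p xs↭ys = sum-↭ (map⁺ _ xs↭ys)

sum-map-zero : (f : A → ℕ) {xs : List A} → All (λ x → f x ≡ 0) xs → sum (map f xs) ≡ 0
sum-map-zero f [] = refl
sum-map-zero f (fx≡0 ∷ fxs≡0) = cong₂ _+_ fx≡0 (sum-map-zero f fxs≡0)

sum-map-balance : (f u v w : A → ℕ) (a b c : ℕ) {xs : List A} →
  All (λ x → f x + a * u x ≡ b * v x + c * w x) xs →
  sum (map f xs) + a * sum (map u xs) ≡ b * sum (map v xs) + c * sum (map w xs)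
sum-map-balance f u v w a b c [] = zeros a b c
  where
  zeros : ∀ a b c → 0 + a * 0 ≡ b * 0 + c * 0
  zeros = solve-∀
sum-map-balance f u v w a b c {x ∷ xs} (eq ∷ eqs) = begin
  (f x + sum (map f xs)) + a * (u x + sum (map u xs))
    ≡⟨ regroup (f x) _ a (u x) _ ⟩
  (f x + a * u x) + (sum (map f xs) + a * sum (map u xs))
    ≡⟨ cong₂ _+_ eq (sum-map-balance f u v w a b c eqs) ⟩
  (b * v x + c * w x) + (b * sum (map v xs) + c * sum (map w xs))
    ≡⟨ regroup₂ b (v x) c (w x) _ _ ⟩
  b * (v x + sum (map v xs)) + c * (w x + sum (map w xs)) ∎
  where
  open ≡-Reasoning
  regroup : ∀ p q a r s → (p + q) + a * (r + s) ≡ (p + a * r) + (q + a * s)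
  regroup = solve-∀
  regroup₂ : ∀ b p c q r s → (b * p + c * q) + (b * r + c * s) ≡ b * (p + r) + c * (q + s)
  regroup₂ = solve-∀

-- Permutations built by insertion

concatMap⁺ : (f : A → List B) {xs ys : List A} → xs ↭ ys → concatMap f xs ↭ concatMap f ys
concatMap⁺ f ↭-refl = ↭-refl
concatMap⁺ f (prep x xs↭ys) = ++⁺ˡ (f x) (concatMap⁺ f xs↭ys)
concatMap⁺ f (swap x y xs↭ys) = ↭-trans (shifts (f x) (f y)) (++⁺ˡ (f y) (++⁺ˡ (f x) (concatMap⁺ f xs↭ys)))
concatMap⁺ f (↭-trans p q) = ↭-trans (concatMap⁺ f p) (concatMap⁺ f q)

concatMap-cong-↭ : {f h : A → List B} → (∀ x → f x ↭ h x) → (xs : List A) → concatMap f xs ↭ concatMap h xs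
concatMap-cong-↭ f↭h [] = ↭-refl
concatMap-cong-↭ f↭h (x ∷ xs) = ++⁺ (f↭h x) (concatMap-cong-↭ f↭h xs)

concatMap-concatMap : {C : Set} (f : B → List C) (h : A → List B) (xs : List A) →
  concatMap f (concatMap h xs) ≡ concatMap (concatMap f ∘ h) xs
concatMap-concatMap f h [] = refl
concatMap-concatMap f h (x ∷ xs) =
  trans (concatMap-++ f (h x) _) (cong (concatMap f (h x) ++_) (concatMap-concatMap f h xs))

concatMap-insertions-map : (x z : ℕ) (τs : List (List ℕ)) →
  concatMap (insertions x) (map (z ∷_) τs)
    ↭ map (x ∷_) (map (z ∷_) τs) ++ map (z ∷_) (concatMap (insertions x) τs)
concatMap-insertions-map x z [] = ↭-refl
concatMap-insertions-map x z (τ ∷ τs) = prep (x ∷ z ∷ τ) (begin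
  later ++ concatMap (insertions x) (map (z ∷_) τs)
    ↭⟨ ++⁺ˡ later (concatMap-insertions-map x z τs) ⟩
  later ++ front ++ map (z ∷_) (concatMap (insertions x) τs)
    ↭⟨ shifts later front ⟩
  front ++ later ++ map (z ∷_) (concatMap (insertions x) τs)
    ≡⟨ cong (front ++_) (map-++ (z ∷_) (insertions x τ) _) ⟨
  front ++ map (z ∷_) (insertions x τ ++ concatMap (insertions x) τs) ∎)
  where
  open PermutationReasoning
  later = map (z ∷_) (insertions x τ)
  front = map (x ∷_) (map (z ∷_) τs)

insertions-comm : (x y : ℕ) (σ : List ℕ) →
  concatMap (insertions x) (insertions y σ) ↭ concatMap (insertions y) (insertions x σ)
insertions-comm x y [] = swap (x ∷ y ∷ []) (y ∷ x ∷ []) ↭-refl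
insertions-comm x y (z ∷ σ) = begin
  (x ∷ y ∷ z ∷ σ) ∷ (y ∷ x ∷ z ∷ σ) ∷ yzx ++ concatMap (insertions x) (map (z ∷_) (insertions y σ))
    ↭⟨ prep _ (prep _ (++⁺ˡ yzx (concatMap-insertions-map x z (insertions y σ)))) ⟩
  (x ∷ y ∷ z ∷ σ) ∷ (y ∷ x ∷ z ∷ σ) ∷ yzx ++ xzy ++ map (z ∷_) (concatMap (insertions x) (insertions y σ))
    ↭⟨ swap _ _ (shifts yzx xzy) ⟩
  (y ∷ x ∷ z ∷ σ) ∷ (x ∷ y ∷ z ∷ σ) ∷ xzy ++ yzx ++ map (z ∷_) (concatMap (insertions x) (insertions y σ))
    ↭⟨ prep _ (prep _ (++⁺ˡ xzy (++⁺ˡ yzx (map⁺ (z ∷_) (insertions-comm x y σ))))) ⟩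
  (y ∷ x ∷ z ∷ σ) ∷ (x ∷ y ∷ z ∷ σ) ∷ xzy ++ yzx ++ map (z ∷_) (concatMap (insertions y) (insertions x σ))
    ↭⟨ prep _ (prep _ (++⁺ˡ xzy (concatMap-insertions-map y z (insertions x σ)))) ⟨
  (y ∷ x ∷ z ∷ σ) ∷ (x ∷ y ∷ z ∷ σ) ∷ xzy ++ concatMap (insertions y) (map (z ∷_) (insertions x σ)) ∎
  where
  open PermutationReasoning
  yzx = map (y ∷_) (map (z ∷_) (insertions x σ))
  xzy = map (x ∷_) (map (z ∷_) (insertions y σ))

perms-∷ʳ : (xs : List ℕ) (x : ℕ) → perms (xs ∷ʳ x) ↭ concatMap (insertions x) (perms xs)
perms-∷ʳ [] x = ↭-refl
perms-∷ʳ (y ∷ xs) x = begin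
  concatMap (insertions y) (perms (xs ∷ʳ x))
    ↭⟨ concatMap⁺ (insertions y) (perms-∷ʳ xs x) ⟩
  concatMap (insertions y) (concatMap (insertions x) (perms xs))
    ≡⟨ concatMap-concatMap (insertions y) (insertions x) (perms xs) ⟩
  concatMap (concatMap (insertions y) ∘ insertions x) (perms xs)
    ↭⟨ concatMap-cong-↭ (insertions-comm y x) (perms xs) ⟩
  concatMap (concatMap (insertions x) ∘ insertions y) (perms xs)
    ≡⟨ concatMap-concatMap (insertions x) (insertions y) (perms xs) ⟨
  concatMap (insertions x) (concatMap (insertions y) (perms xs)) ∎
  where open PermutationReasoning

insertions-↭ : (x : ℕ) (σ : List ℕ) → All (_↭ x ∷ σ) (insertions x σ)
insertions-↭ x [] = ↭-refl ∷ []
insertions-↭ x (y ∷ σ) =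
  ↭-refl ∷ Allₚ.map⁺ (All.map (λ τ↭xσ → ↭-trans (prep y τ↭xσ) (swap y x ↭-refl)) (insertions-↭ x σ))

perms-↭ : (xs : List ℕ) → All (_↭ xs) (perms xs)
perms-↭ [] = ↭-refl ∷ []
perms-↭ (x ∷ xs) = Allₚ.concat⁺ (Allₚ.map⁺ (All.map insertions-↭xs (perms-↭ xs)))
  where
  insertions-↭xs : {σ : List ℕ} → σ ↭ xs → All (_↭ x ∷ xs) (insertions x σ)
  insertions-↭xs σ↭xs = All.map (λ τ↭xσ → ↭-trans τ↭xσ (prep x σ↭xs)) (insertions-↭ x _)

Hole : Set → Set
Hole A = List A × A × List A

plug : Hole A → List A
plug (ys , x , zs) = ys ++ x ∷ zs

focus : Hole A → A
focus (_ , x , _) = x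

holes : List A → List (Hole A)
holes [] = []
holes (x ∷ xs) = ([] , x , xs) ∷ map (λ (ys , y , zs) → (x ∷ ys , y , zs)) (holes xs)

map-focus-holes : (xs : List A) → map focus (holes xs) ≡ xs
map-focus-holes [] = refl
map-focus-holes (x ∷ xs) = cong (x ∷_) (trans (sym (map-∘ (holes xs))) (map-focus-holes xs))

plug-holes : (xs : List A) → All (λ h → plug h ≡ xs) (holes xs)
plug-holes [] = []
plug-holes (x ∷ xs) = refl ∷ Allₚ.map⁺ (All.map (cong (x ∷_)) (plug-holes xs))

focus-holes : {R : A → Set} {xs : List A} → All R xs → All (R ∘ focus) (holes xs)
focus-holes {xs = xs} Rxs = Allₚ.map⁻ (subst (All _) (sym (map-focus-holes xs)) Rxs)

Pair : Set
Pair = ℕ × ℕ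

subdivide : ℕ → Hole Pair → List Pair
subdivide m (ps , (x , y) , qs) = ps ++ (x , m) ∷ (m , y) ∷ qs

cyclicPairsFrom-insertions : (m f a : ℕ) (σ : List ℕ) →
  map (λ τ → cyclicPairsFrom f (a ∷ τ)) (insertions m σ) ≡ map (subdivide m) (holes (cyclicPairsFrom f (a ∷ σ)))
cyclicPairsFrom-insertions m f a [] = refl
cyclicPairsFrom-insertions m f a (y ∷ σ) = cong (((a , m) ∷ (m , y) ∷ cyclicPairsFrom f (y ∷ σ)) ∷_) (begin
  map (λ τ → cyclicPairsFrom f (a ∷ τ)) (map (y ∷_) (insertions m σ))
    ≡⟨ map-∘ (insertions m σ) ⟨
  map (((a , y) ∷_) ∘ (λ τ → cyclicPairsFrom f (y ∷ τ))) (insertions m σ)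
    ≡⟨ map-∘ (insertions m σ) ⟩
  map ((a , y) ∷_) (map (λ τ → cyclicPairsFrom f (y ∷ τ)) (insertions m σ))
    ≡⟨ cong (map ((a , y) ∷_)) (cyclicPairsFrom-insertions m f y σ) ⟩
  map ((a , y) ∷_) (map (subdivide m) (holes (cyclicPairsFrom f (y ∷ σ))))
    ≡⟨ map-∘ (holes (cyclicPairsFrom f (y ∷ σ))) ⟨
  map (((a , y) ∷_) ∘ subdivide m) (holes (cyclicPairsFrom f (y ∷ σ)))
    ≡⟨ map-∘ (holes (cyclicPairsFrom f (y ∷ σ))) ⟩
  map (subdivide m) (map (λ (ps , p , qs) → ((a , y) ∷ ps , p , qs)) (holes (cyclicPairsFrom f (y ∷ σ)))) ∎)
  where open ≡-Reasoning

map-proj₂-cyclicPairsFrom : (f a : ℕ) (σ : List ℕ) → map proj₂ (cyclicPairsFrom f (a ∷ σ)) ≡ σ ∷ʳ f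
map-proj₂-cyclicPairsFrom f a [] = refl
map-proj₂-cyclicPairsFrom f a (y ∷ σ) = cong (y ∷_) (map-proj₂-cyclicPairsFrom f y σ)

All-cyclicPairsFrom : {R : ℕ → Set} {f a : ℕ} {σ : List ℕ} → All R (a ∷ σ) → R f →
  All (λ (x , y) → R x × R y) (cyclicPairsFrom f (a ∷ σ))
All-cyclicPairsFrom {σ = []} (Ra ∷ []) Rf = (Ra , Rf) ∷ []
All-cyclicPairsFrom {σ = y ∷ σ} (Ra ∷ Ry ∷ Rσ) Rf = (Ra , Ry) ∷ All-cyclicPairsFrom (Ry ∷ Rσ) Rf

-- inCo π and dropEO π unfold to dropsEndOdd and evenOddDrops of cyclicPairs π.
isDrop : Pair → Bool
isDrop (a , b) = b <ᵇ a

endsOdd : Pair → Bool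
endsOdd (_ , b) = isOdd b

isEvenOddDrop : Pair → Bool
isEvenOddDrop p = isDrop p ∧ isEvenOdd p

endsOddIfDrop : Pair → Bool
endsOddIfDrop p = not (isDrop p) ∨ endsOdd p

dropsEndOdd : List Pair → Bool
dropsEndOdd ps = allᵇ endsOdd (filterᵇ isDrop ps)

evenOddDrops : List Pair → ℕ
evenOddDrops ps = length (filterᵇ isEvenOdd (filterᵇ isDrop ps))

hasWeight : ℕ → List Pair → Bool
hasWeight k ps = dropsEndOdd ps ∧ (evenOddDrops ps ≡ᵇ k)

allᵇ-++ : (p : A → Bool) (xs ys : List A) → allᵇ p (xs ++ ys) ≡ allᵇ p xs ∧ allᵇ p ys
allᵇ-++ p [] ys = refl
allᵇ-++ p (x ∷ xs) ys = trans (cong (p x ∧_) (allᵇ-++ p xs ys)) (sym (∧-assoc (p x) _ _))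

dropsEndOdd≡allᵇ : (ps : List Pair) → dropsEndOdd ps ≡ allᵇ endsOddIfDrop ps
dropsEndOdd≡allᵇ [] = refl
dropsEndOdd≡allᵇ (p ∷ ps) with isDrop p
... | true = cong (endsOdd p ∧_) (dropsEndOdd≡allᵇ ps)
... | false = dropsEndOdd≡allᵇ ps

evenOddDrops≡count : (ps : List Pair) → evenOddDrops ps ≡ count isEvenOddDrop ps
evenOddDrops≡count ps = trans (length-filterᵇ isEvenOdd (filterᵇ isDrop ps)) (count-filterᵇ isEvenOdd isDrop ps)

-- Inserting the maximum entry

<ᵇ-true : {m n : ℕ} → m < n → (m <ᵇ n) ≡ true
<ᵇ-true m<n = Equivalence.to T-≡ (<⇒<ᵇ m<n)

<ᵇ-false : {m n : ℕ} → m < n → (n <ᵇ m) ≡ false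
<ᵇ-false {m} {n} m<n with n <ᵇ m in eq
... | false = refl
... | true = contradiction (<ᵇ⇒< n m (Equivalence.from T-≡ eq)) (<-asym m<n)

allᵇ-endsOddIfDrop-subdivide : {m x y : ℕ} → x < m → y < m → (ps qs : List Pair) →
  allᵇ endsOddIfDrop (subdivide m (ps , (x , y) , qs)) ≡ allᵇ endsOddIfDrop ps ∧ (isOdd y ∧ allᵇ endsOddIfDrop qs)
allᵇ-endsOddIfDrop-subdivide {m} {x} {y} x<m y<m ps qs
  rewrite allᵇ-++ endsOddIfDrop ps ((x , m) ∷ (m , y) ∷ qs) | <ᵇ-false x<m | <ᵇ-true y<m = refl

count-isEvenOddDrop-subdivide : {m x y : ℕ} → x < m → y < m → (ps qs : List Pair) →
  count isEvenOddDrop (subdivide m (ps , (x , y) , qs))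
    ≡ count isEvenOddDrop ps + (χ (isEven m ∧ isOdd y) + count isEvenOddDrop qs)
count-isEvenOddDrop-subdivide {m} {x} {y} x<m y<m ps qs
  rewrite count-++ isEvenOddDrop ps ((x , m) ∷ (m , y) ∷ qs) | <ᵇ-false x<m | <ᵇ-true y<m = refl

isEvenOddDrop⇒endsOdd : (p : Pair) → isEvenOddDrop p ≡ true → endsOdd p ≡ true
isEvenOddDrop⇒endsOdd (a , b) eod with b <ᵇ a | isEven a | isOdd b
... | true | true | true = refl

dropsEndOdd-subdivide : {m x y : ℕ} → x < m → y < m → (ps qs : List Pair) →
  dropsEndOdd (subdivide m (ps , (x , y) , qs)) ≡ isOdd y ∧ dropsEndOdd (ps ++ (x , y) ∷ qs)
dropsEndOdd-subdivide {m} {x} {y} x<m y<m ps qs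
  rewrite dropsEndOdd≡allᵇ (subdivide m (ps , (x , y) , qs)) | dropsEndOdd≡allᵇ (ps ++ (x , y) ∷ qs)
        | allᵇ-endsOddIfDrop-subdivide x<m y<m ps qs | allᵇ-++ endsOddIfDrop ps ((x , y) ∷ qs)
  with isOdd y in odd
... | true rewrite ∨-zeroʳ (not (y <ᵇ x)) = refl
... | false = ∧-zeroʳ (allᵇ endsOddIfDrop ps)

evenOddDrops-subdivide : {m x y : ℕ} → x < m → y < m → isOdd y ≡ true → (ps qs : List Pair) →
  evenOddDrops (subdivide m (ps , (x , y) , qs)) ≡ χ (isEven m) + (evenOddDrops ps + evenOddDrops qs)
evenOddDrops-subdivide {m} {x} {y} x<m y<m odd ps qs
  rewrite evenOddDrops≡count (subdivide m (ps , (x , y) , qs)) | evenOddDrops≡count ps | evenOddDrops≡count qs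
        | count-isEvenOddDrop-subdivide x<m y<m ps qs | odd | ∧-identityʳ (isEven m)
  = x∙yz≈y∙xz (count isEvenOddDrop ps) (χ (isEven m)) (count isEvenOddDrop qs)

evenOddDrops-plug : (ps : List Pair) (p : Pair) (qs : List Pair) →
  evenOddDrops (ps ++ p ∷ qs) ≡ χ (isEvenOddDrop p) + (evenOddDrops ps + evenOddDrops qs)
evenOddDrops-plug ps p qs
  rewrite evenOddDrops≡count (ps ++ p ∷ qs) | evenOddDrops≡count ps | evenOddDrops≡count qs
        | count-++ isEvenOddDrop ps (p ∷ qs)
  = x∙yz≈y∙xz (count isEvenOddDrop ps) (χ (isEvenOddDrop p)) (count isEvenOddDrop qs)

+-cancelˡ-≡ᵇ : (e m n : ℕ) → (e + m ≡ᵇ e + n) ≡ (m ≡ᵇ n)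
+-cancelˡ-≡ᵇ zero m n = refl
+-cancelˡ-≡ᵇ (suc e) m n = +-cancelˡ-≡ᵇ e m n

χ-≡ᵇ-scale : (b : Bool) (c k : ℕ) → χ (b ∧ (c ≡ᵇ k)) * c ≡ k * χ (b ∧ (c ≡ᵇ k))
χ-≡ᵇ-scale false c k = sym (*-zeroʳ k)
χ-≡ᵇ-scale true c k with c ≡ᵇ k in c≡k
... | false = sym (*-zeroʳ k)
... | true rewrite ≡ᵇ⇒≡ c k (Equivalence.from T-≡ c≡k) = *-comm 1 k

-- One inserted position: o says that the subdivided pair ends in an odd entry, E that it
-- is an even-odd drop and b that the old cycle lies in 𝔆ᵒ; c and c₀ are the numbers of
-- even-odd drops of the new and the old cycle, s that of the other pairs, and e is 1 if
-- the inserted maximum is even.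
weight-balance : (o E b d : Bool) (e s c c₀ k : ℕ) →
  (E ≡ true → o ≡ true) → d ≡ o ∧ b → (o ≡ true → c ≡ e + s) → c₀ ≡ χ E + s →
  χ (d ∧ (c ≡ᵇ e + k)) + χ (b ∧ (c₀ ≡ᵇ k)) * χ E
    ≡ χ (b ∧ (c₀ ≡ᵇ k)) * χ o + χ (b ∧ (c₀ ≡ᵇ suc k)) * χ E
weight-balance false true b _ e s c _ k E⇒o _ _ _ with () ← E⇒o refl
weight-balance false false b _ e s c _ k _ refl _ refl
  rewrite *-zeroʳ (χ (b ∧ (s ≡ᵇ k))) | *-zeroʳ (χ (b ∧ (s ≡ᵇ suc k))) = refl
weight-balance true E b _ e s c _ k _ refl c≡e+s refl rewrite c≡e+s refl | +-cancelˡ-≡ᵇ e s k with E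
... | false
  rewrite *-zeroʳ (χ (b ∧ (s ≡ᵇ k))) | *-zeroʳ (χ (b ∧ (s ≡ᵇ suc k))) | *-identityʳ (χ (b ∧ (s ≡ᵇ k))) = refl
... | true
  rewrite *-identityʳ (χ (b ∧ (suc s ≡ᵇ k))) | *-identityʳ (χ (b ∧ (s ≡ᵇ k))) = +-comm (χ (b ∧ (s ≡ᵇ k))) _

weight-positive : (o b d : Bool) (s c : ℕ) → d ≡ o ∧ b → (o ≡ true → c ≡ suc s) →
  χ (d ∧ (c ≡ᵇ 0)) ≡ 0
weight-positive false b _ s c refl _ = refl
weight-positive true b _ s c refl c≡1+s rewrite c≡1+s refl | ∧-zeroʳ b = refl

Below : ℕ → Pair → Set
Below m (x , y) = x < m × y < m

hasWeight-subdivide : {m : ℕ} (k : ℕ) {P : List Pair} (h : Hole Pair) → plug h ≡ P → Below m (focus h) →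
  χ (hasWeight (χ (isEven m) + k) (subdivide m h)) + χ (hasWeight k P) * χ (isEvenOddDrop (focus h))
    ≡ χ (hasWeight k P) * χ (endsOdd (focus h)) + χ (hasWeight (suc k) P) * χ (isEvenOddDrop (focus h))
hasWeight-subdivide {m} k (ps , (x , y) , qs) refl (x<m , y<m) =
  weight-balance (isOdd y) (isEvenOddDrop (x , y)) (dropsEndOdd (ps ++ (x , y) ∷ qs)) _
    (χ (isEven m)) (evenOddDrops ps + evenOddDrops qs) _ _ k
    (isEvenOddDrop⇒endsOdd (x , y)) (dropsEndOdd-subdivide x<m y<m ps qs)
    (λ odd → evenOddDrops-subdivide x<m y<m odd ps qs) (evenOddDrops-plug ps (x , y) qs)

hasWeight-zero-subdivide : {m : ℕ} → isEven m ≡ true → (h : Hole Pair) → Below m (focus h) →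
  χ (hasWeight 0 (subdivide m h)) ≡ 0
hasWeight-zero-subdivide {m} even (ps , (x , y) , qs) (x<m , y<m) =
  weight-positive (isOdd y) (dropsEndOdd (ps ++ (x , y) ∷ qs)) _ (evenOddDrops ps + evenOddDrops qs) _
    (dropsEndOdd-subdivide x<m y<m ps qs)
    (λ odd → trans (evenOddDrops-subdivide x<m y<m odd ps qs) (cong (λ b → χ b + _) even))

count-focus-holes : (p : A → Bool) (xs : List A) → count (p ∘ focus) (holes xs) ≡ count p xs
count-focus-holes p xs = trans (sym (count-map p focus (holes xs))) (cong (count p) (map-focus-holes xs))

count-endsOdd-cyclicPairs : (σ : List ℕ) → count endsOdd (cyclicPairs (1 ∷ σ)) ≡ suc (count isOdd σ)
count-endsOdd-cyclicPairs σ = begin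
  count endsOdd (cyclicPairs (1 ∷ σ))     ≡⟨ count-map isOdd proj₂ (cyclicPairs (1 ∷ σ)) ⟨
  count isOdd (map proj₂ (cyclicPairs (1 ∷ σ))) ≡⟨ cong (count isOdd) (map-proj₂-cyclicPairsFrom 1 1 σ) ⟩
  count isOdd (σ ∷ʳ 1)                    ≡⟨ count-++ isOdd σ [ 1 ] ⟩
  count isOdd σ + 1                        ≡⟨ +-comm (count isOdd σ) 1 ⟩
  suc (count isOdd σ)                      ∎
  where open ≡-Reasoning

count-insertions : (m : ℕ) (p : List Pair → Bool) (σ : List ℕ) →
  count (λ τ → p (cyclicPairs (1 ∷ τ))) (insertions m σ)
    ≡ count (p ∘ subdivide m) (holes (cyclicPairs (1 ∷ σ)))
count-insertions m p σ = begin
  count (λ τ → p (cyclicPairs (1 ∷ τ))) (insertions m σ)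
    ≡⟨ count-map p (λ τ → cyclicPairs (1 ∷ τ)) (insertions m σ) ⟨
  count p (map (λ τ → cyclicPairs (1 ∷ τ)) (insertions m σ))
    ≡⟨ cong (count p) (cyclicPairsFrom-insertions m 1 1 σ) ⟩
  count p (map (subdivide m) (holes (cyclicPairs (1 ∷ σ))))
    ≡⟨ count-map p (subdivide m) (holes (cyclicPairs (1 ∷ σ))) ⟩
  count (p ∘ subdivide m) (holes (cyclicPairs (1 ∷ σ))) ∎
  where open ≡-Reasoning

insertions-balance : (m k : ℕ) (σ : List ℕ) → All (_< m) (1 ∷ σ) →
  let I = λ w → χ (hasWeight w (cyclicPairs (1 ∷ σ))) in
  count (λ τ → hasWeight (χ (isEven m) + k) (cyclicPairs (1 ∷ τ))) (insertions m σ) + k * I k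
    ≡ suc (count isOdd σ) * I k + suc k * I (suc k)
insertions-balance m k σ σ<m = begin
  count (λ τ → hasWeight (χ (isEven m) + k) (cyclicPairs (1 ∷ τ))) (insertions m σ) + k * I k
    ≡⟨ cong₂ _+_ (count-insertions m (hasWeight (χ (isEven m) + k)) σ)
                 (sym (χ-≡ᵇ-scale (dropsEndOdd P) (evenOddDrops P) k)) ⟩
  count (hasWeight (χ (isEven m) + k) ∘ subdivide m) (holes P) + I k * evenOddDrops P
    ≡⟨ cong (λ c → new + I k * c) eod≡ ⟩
  count (hasWeight (χ (isEven m) + k) ∘ subdivide m) (holes P) + I k * count (isEvenOddDrop ∘ focus) (holes P)
    ≡⟨ sum-map-balance _ _ _ _ (I k) (I k) (I (suc k))
         (All.zipWith (λ (plug≡P , below) → hasWeight-subdivide k _ plug≡P below)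
           (plug-holes P , focus-holes (All-cyclicPairsFrom σ<m (head σ<m)))) ⟩
  I k * count (endsOdd ∘ focus) (holes P) + I (suc k) * count (isEvenOddDrop ∘ focus) (holes P)
    ≡⟨ cong₂ (λ n c → I k * n + I (suc k) * c) odd≡ (sym eod≡) ⟩
  I k * suc (count isOdd σ) + I (suc k) * evenOddDrops P
    ≡⟨ cong₂ _+_ (*-comm (I k) _) (χ-≡ᵇ-scale (dropsEndOdd P) (evenOddDrops P) (suc k)) ⟩
  suc (count isOdd σ) * I k + suc k * I (suc k) ∎
  where
  open ≡-Reasoning
  P = cyclicPairs (1 ∷ σ)
  I = λ w → χ (hasWeight w P)
  new = count (hasWeight (χ (isEven m) + k) ∘ subdivide m) (holes P)
  eod≡ : evenOddDrops P ≡ count (isEvenOddDrop ∘ focus) (holes P)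
  eod≡ = trans (evenOddDrops≡count P) (sym (count-focus-holes isEvenOddDrop P))
  odd≡ : count (endsOdd ∘ focus) (holes P) ≡ suc (count isOdd σ)
  odd≡ = trans (count-focus-holes endsOdd P) (count-endsOdd-cyclicPairs σ)

insertions-zero : (m : ℕ) → isEven m ≡ true → (σ : List ℕ) → All (_< m) (1 ∷ σ) →
  count (λ τ → hasWeight 0 (cyclicPairs (1 ∷ τ))) (insertions m σ) ≡ 0
insertions-zero m even σ σ<m = trans (count-insertions m (hasWeight 0) σ)
  (sum-map-zero _ (All.map (λ {h} → hasWeight-zero-subdivide even h)
    (focus-holes (All-cyclicPairsFrom σ<m (head σ<m)))))

-- cycles (suc j) unfolds to map (1 ∷_) (perms (fromTwo j)).
fromTwo : ℕ → List ℕ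
fromTwo j = map (λ i → suc (suc i)) (upTo j)

fromTwo-suc : (j : ℕ) → fromTwo (suc j) ≡ fromTwo j ∷ʳ suc (suc j)
fromTwo-suc j = trans (cong (map (λ i → suc (suc i))) (sym (upTo-∷ʳ j))) (map-++ _ (upTo j) [ j ])

fromTwo-below : (j : ℕ) → All (_< suc (suc j)) (fromTwo j)
fromTwo-below j = Allₚ.map⁺ (All.map (λ i<j → s<s (s<s i<j)) (Allₚ.all-upTo j))

count-isOdd-fromTwo-+2 : (j : ℕ) → count isOdd (fromTwo (suc (suc j))) ≡ suc (count isOdd (fromTwo j))
count-isOdd-fromTwo-+2 j = begin
  count isOdd (fromTwo (suc (suc j)))
    ≡⟨ cong (count isOdd) (trans (fromTwo-suc (suc j)) (cong (_∷ʳ suc (suc (suc j))) (fromTwo-suc j))) ⟩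
  count isOdd ((fromTwo j ∷ʳ suc (suc j)) ∷ʳ suc (suc (suc j)))
    ≡⟨ cong (count isOdd) (++-assoc (fromTwo j) [ suc (suc j) ] [ suc (suc (suc j)) ]) ⟩
  count isOdd (fromTwo j ++ suc (suc j) ∷ suc (suc (suc j)) ∷ [])
    ≡⟨ count-++ isOdd (fromTwo j) _ ⟩
  count isOdd (fromTwo j) + count isOdd (suc (suc j) ∷ suc (suc (suc j)) ∷ [])
    ≡⟨ cong (count isOdd (fromTwo j) +_) (two-consecutive j) ⟩
  count isOdd (fromTwo j) + 1
    ≡⟨ +-comm (count isOdd (fromTwo j)) 1 ⟩
  suc (count isOdd (fromTwo j)) ∎
  where
  open ≡-Reasoning
  two-consecutive : (j : ℕ) → count isOdd (suc (suc j) ∷ suc (suc (suc j)) ∷ []) ≡ 1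
  two-consecutive j with isEven j
  ... | true = refl
  ... | false = refl

count-isOdd-fromTwo : (i : ℕ) → count isOdd (fromTwo (2 * i)) ≡ i × count isOdd (fromTwo (suc (2 * i))) ≡ i
count-isOdd-fromTwo zero = refl , refl
count-isOdd-fromTwo (suc i) =
  trans (cong (count isOdd ∘ fromTwo) (*-suc 2 i))
    (trans (count-isOdd-fromTwo-+2 (2 * i)) (cong suc (proj₁ (count-isOdd-fromTwo i)))) ,
  trans (cong (count isOdd ∘ fromTwo ∘ suc) (*-suc 2 i))
    (trans (count-isOdd-fromTwo-+2 (suc (2 * i))) (cong suc (proj₂ (count-isOdd-fromTwo i))))

isEven-+2 : (j : ℕ) → isEven (suc (suc j)) ≡ isEven j
isEven-+2 j = not-involutive (isEven j)

isEven-2* : (i : ℕ) → isEven (2 * i) ≡ true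
isEven-2* zero = refl
isEven-2* (suc i) = trans (cong isEven (*-suc 2 i)) (trans (isEven-+2 (2 * i)) (isEven-2* i))

isEven-2+2* : (i : ℕ) → isEven (2 + 2 * i) ≡ true
isEven-2+2* i = trans (isEven-+2 (2 * i)) (isEven-2* i)

isEven-3+2* : (i : ℕ) → isEven (3 + 2 * i) ≡ false
isEven-3+2* i = trans (isEven-+2 (suc (2 * i))) (cong not (isEven-2* i))

cycleCount : ℕ → ℕ → ℕ
cycleCount m k = count (λ π → hasWeight k (cyclicPairs π)) (cycles m)

g≡cycleCount : (m k : ℕ) → g m k ≡ ℤ.+ cycleCount m k
g≡cycleCount m k = cong ℤ.+_ (length-filterᵇ _ (cycles m))

cycleCount-suc : (j k : ℕ) →
  cycleCount (suc j) k ≡ sum (map (λ σ → χ (hasWeight k (cyclicPairs (1 ∷ σ)))) (perms (fromTwo j)))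
cycleCount-suc j k = count-map _ (1 ∷_) (perms (fromTwo j))

cycleCount-suc-suc : (j k : ℕ) →
  cycleCount (suc (suc j)) k
    ≡ sum (map (λ σ → count (λ τ → hasWeight k (cyclicPairs (1 ∷ τ))) (insertions (suc (suc j)) σ))
               (perms (fromTwo j)))
cycleCount-suc-suc j k = begin
  cycleCount (suc (suc j)) k
    ≡⟨ count-map _ (1 ∷_) (perms (fromTwo (suc j))) ⟩
  count p (perms (fromTwo (suc j)))
    ≡⟨ cong (count p ∘ perms) (fromTwo-suc j) ⟩
  count p (perms (fromTwo j ∷ʳ suc (suc j)))
    ≡⟨ count-↭ p (perms-∷ʳ (fromTwo j) (suc (suc j))) ⟩
  count p (concatMap (insertions (suc (suc j))) (perms (fromTwo j)))
    ≡⟨ count-concatMap p (insertions (suc (suc j))) (perms (fromTwo j)) ⟩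
  sum (map (count p ∘ insertions (suc (suc j))) (perms (fromTwo j))) ∎
  where
  open ≡-Reasoning
  p = λ τ → hasWeight k (cyclicPairs (1 ∷ τ))

module _ (j : ℕ) where

  private
    m = suc (suc j)
    n = suc (count isOdd (fromTwo j))

  perms-below : All (λ σ → All (_< m) (1 ∷ σ)) (perms (fromTwo j))
  perms-below = All.map (λ σ↭ → s<s z<s ∷ All-resp-↭ (↭-sym σ↭) (fromTwo-below j)) (perms-↭ (fromTwo j))

  insertions-balance-↭ : (k : ℕ) {σ : List ℕ} → σ ↭ fromTwo j → All (_< m) (1 ∷ σ) →
    let I = λ w → χ (hasWeight w (cyclicPairs (1 ∷ σ))) in
    count (λ τ → hasWeight (χ (isEven m) + k) (cyclicPairs (1 ∷ τ))) (insertions m σ) + k * I k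
      ≡ n * I k + suc k * I (suc k)
  insertions-balance-↭ k {σ} σ↭ σ<m rewrite sym (count-↭ isOdd σ↭) = insertions-balance m k σ σ<m

  cycleCount-balance : {e n′ : ℕ} → χ (isEven m) ≡ e → n ≡ n′ → (k : ℕ) →
    cycleCount m (e + k) + k * cycleCount (suc j) k ≡ n′ * cycleCount (suc j) k + suc k * cycleCount (suc j) (suc k)
  cycleCount-balance refl refl k
    rewrite cycleCount-suc-suc j (χ (isEven m) + k) | cycleCount-suc j k | cycleCount-suc j (suc k) =
    sum-map-balance _ _ _ _ k n (suc k)
      (All.zipWith (λ (σ↭ , σ<m) → insertions-balance-↭ k σ↭ σ<m) (perms-↭ (fromTwo j) , perms-below))

  cycleCount-zero : isEven m ≡ true → cycleCount m 0 ≡ 0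
  cycleCount-zero even = trans (cycleCount-suc-suc j 0) (sum-map-zero _ (All.map (insertions-zero m even _) perms-below))

oddStep : ℕ → Poly → Poly
oddStep n p = n ·ₚ p -ₚ yₚ (dₚ p) +ₚ dₚ p

yₚ-dₚ : (p : Poly) (k : ℕ) → yₚ (dₚ p) k ≡ ℤ.+ k ℤ.* p k
yₚ-dₚ p zero = refl
yₚ-dₚ p (suc k) = refl

x+y≡z+w⇒x≡z-y+w : (x y z w : ℤ) → x ℤ.+ y ≡ z ℤ.+ w → x ≡ z ℤ.- y ℤ.+ w
x+y≡z+w⇒x≡z-y+w x y z w eq = begin
  x                       ≡⟨ cancel x y ⟩
  x ℤ.+ y ℤ.- y           ≡⟨ cong (ℤ._- y) eq ⟩
  z ℤ.+ w ℤ.- y           ≡⟨ reorder z w y ⟩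
  z ℤ.- y ℤ.+ w           ∎
  where
  open ≡-Reasoning
  cancel : ∀ x y → x ≡ x ℤ.+ y ℤ.- y
  cancel = ℤ-solve-∀
  reorder : ∀ z w y → z ℤ.+ w ℤ.- y ≡ z ℤ.- y ℤ.+ w
  reorder = ℤ-solve-∀

oddStep-coefficient : (p : Poly) {X n k a b : ℕ} → p k ≡ ℤ.+ a → p (suc k) ≡ ℤ.+ b →
  X + k * a ≡ n * a + suc k * b → ℤ.+ X ≡ oddStep n p k
oddStep-coefficient p {X} {n} {k} {a} {b} pk≡a pk+1≡b balance
  rewrite yₚ-dₚ p k | pk≡a | pk+1≡b =
  x+y≡z+w⇒x≡z-y+w (ℤ.+ X) (ℤ.+ k ℤ.* ℤ.+ a) (ℤ.+ n ℤ.* ℤ.+ a) (ℤ.+ suc k ℤ.* ℤ.+ b) (begin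
    ℤ.+ X ℤ.+ ℤ.+ k ℤ.* ℤ.+ a                ≡⟨ cong (λ z → ℤ.+ X ℤ.+ z) (ℤ.pos-* k a) ⟨
    ℤ.+ X ℤ.+ ℤ.+ (k * a)                   ≡⟨ ℤ.pos-+ X (k * a) ⟨
    ℤ.+ (X + k * a)                         ≡⟨ cong ℤ.+_ balance ⟩
    ℤ.+ (n * a + suc k * b)                 ≡⟨ ℤ.pos-+ (n * a) (suc k * b) ⟩
    ℤ.+ (n * a) ℤ.+ ℤ.+ (suc k * b)         ≡⟨ cong₂ ℤ._+_ (ℤ.pos-* n a) (ℤ.pos-* (suc k) b) ⟩
    ℤ.+ n ℤ.* ℤ.+ a ℤ.+ ℤ.+ suc k ℤ.* ℤ.+ b ∎)
  where open ≡-Reasoning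

g-one : g 1 ≈ₚ oneₚ
g-one zero = refl
g-one (suc k) = refl

yₚ-oddStep : (n : ℕ) (p : Poly) → yₚ (oddStep n p) ≈ₚ n ·ₚ yₚ p -ₚ yₚ (yₚ (dₚ p)) +ₚ yₚ (dₚ p)
yₚ-oddStep n p zero rewrite ℤ.*-zeroʳ (ℤ.+ n) = refl
yₚ-oddStep n p (suc k) = refl

g-even-cycles : (i : ℕ) → g (2 + 2 * i) ≈ₚ yₚ (oddStep (suc i) (g (1 + 2 * i)))
g-even-cycles i zero
  rewrite g≡cycleCount (2 + 2 * i) 0 | cycleCount-zero (2 * i) (isEven-2+2* i) = refl
g-even-cycles i (suc k) = trans (g≡cycleCount (2 + 2 * i) (suc k))
  (oddStep-coefficient (g (1 + 2 * i)) {n = suc i} (g≡cycleCount (1 + 2 * i) k) (g≡cycleCount (1 + 2 * i) (suc k))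
    (cycleCount-balance (2 * i) (cong χ (isEven-2+2* i))
      (cong suc (proj₁ (count-isOdd-fromTwo i))) k))

g-odd-cycles : (i : ℕ) → g (3 + 2 * i) ≈ₚ oddStep (suc i) (g (2 + 2 * i))
g-odd-cycles i k = trans (g≡cycleCount (3 + 2 * i) k)
  (oddStep-coefficient (g (2 + 2 * i)) {n = suc i} (g≡cycleCount (2 + 2 * i) k) (g≡cycleCount (2 + 2 * i) (suc k))
    (cycleCount-balance (suc (2 * i)) (cong χ (isEven-3+2* i))
      (cong suc (proj₂ (count-isOdd-fromTwo i))) k))

g-even : (n : ℕ) → 1 ≤ n →
  g (2 * n) ≈ₚ n ·ₚ yₚ (g (2 * n ∸ 1)) -ₚ yₚ (yₚ (dₚ (g (2 * n ∸ 1)))) +ₚ yₚ (dₚ (g (2 * n ∸ 1)))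
g-even (suc i) _ =
  subst (λ m → g m ≈ₚ suc i ·ₚ yₚ (g (m ∸ 1)) -ₚ yₚ (yₚ (dₚ (g (m ∸ 1)))) +ₚ yₚ (dₚ (g (m ∸ 1))))
    (sym (*-suc 2 i)) (λ k → trans (g-even-cycles i k) (yₚ-oddStep (suc i) (g (1 + 2 * i)) k))

g-odd : (n : ℕ) → 1 ≤ n → g (2 * n + 1) ≈ₚ n ·ₚ g (2 * n) -ₚ yₚ (dₚ (g (2 * n))) +ₚ dₚ (g (2 * n))
g-odd (suc i) _ =
  subst (λ m → g (m + 1) ≈ₚ oddStep (suc i) (g m)) (sym (*-suc 2 i))
    (λ k → trans (cong (λ m → g m k) (+-comm (2 + 2 * i) 1)) (g-odd-cycles i k))

lemma4p1 : (g 1 ≈ₚ oneₚ)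
    × (∀ (n : ℕ) → 1 ≤ n →
        (g (2 * n) ≈ₚ n ·ₚ yₚ (g (2 * n ∸ 1)) -ₚ yₚ (yₚ (dₚ (g (2 * n ∸ 1)))) +ₚ yₚ (dₚ (g (2 * n ∸ 1))))
        × (g (2 * n + 1) ≈ₚ n ·ₚ g (2 * n) -ₚ yₚ (dₚ (g (2 * n))) +ₚ dₚ (g (2 * n))))
lemma4p1 = g-one , λ n 1≤n → g-even n 1≤n , g-odd n 1≤n
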